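{- Fix positive integers $r,s$ and an integer $n$. Let $\sigma_0=(x_0,y_0,z_0)\in\mathbf{Rec}$ be a state with $g_{r,s}(\sigma_0)=n$, and let $y\ge y_0$ be an integer with $y\equiv y_0 \pmod s$. Let $$A_n(y)=\{x\in\mathbb{Z}: x\le 0,\ x\equiv x_0 \pmod r,\ x\le z_n(x,y)\le y\}.$$ Then $A_n(y)$ is a nonempty spaced interval with increment $r$, i.e. $A_n(y)=\{a^-(y),a^-(y)+r,a^-(y)+2r,\dots,a^+(y)\}$ for some integers $a^-(y)\le a^+(y)$; furthermore the upper endpoint satisfies $a^+(y+s)\le a^+(y)$.
   Context: Fix positive integers $r,s$. The recurrent states $\mathbf{Rec}$ of the one-dimensional generalized rotor-router model are identified with integer triples $(x,y,z)$ with $x\le0\le y$, $x\le z\le y$ (the state with occupied interval $[x,y+s-1]$, labels $R$ on $[x,z-1]$, $L$ on $[z,y-1]$, $R$ on $[y,y+s-1]$); on them the map is $f_{r,s}(x,y,z)=(x,y+s,z-y)$ if $x+y\le z$ and $(x-r,y,z-x+1)$ if $x+y>z$. Further, $g_{r,s}(x,y,z)=sx^2-ry^2+(r-2)sx+rsy-2rsz$, and $z_n(x,y)=\frac{sx^2-ry^2+(r-2)sx+rsy-n}{2rs}$ is the unique $z$ with $g_{r,s}(x,y,z)=n$. -}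

module Defs where

open import Data.Nat using (ℕ)
open import Data.Integer using (ℤ; +_; _+_; _-_; _*_; _≤_; 0ℤ; 1ℤ)
open import Data.Integer.Divisibility using (_∣_)
open import Data.Product using (_×_; ∃₂)

Rec : ℤ → ℤ → ℤ → Set
Rec x y z = (x ≤ 0ℤ) × (0ℤ ≤ y) × (x ≤ z) × (z ≤ y)

g : ℕ → ℕ → ℤ → ℤ → ℤ → ℤ
g r s x y z =
  (+ s) * x * x - (+ r) * y * y + ((+ r) - (+ 2)) * (+ s) * x
  + (+ r) * (+ s) * y - (+ 2) * (+ r) * (+ s) * z

-- Numerator of z_n(x,y):  z_n(x,y) = numZ r s n x y / (2 r s)
numZ : ℕ → ℕ → ℤ → ℤ → ℤ → ℤ
numZ r s n x y =
  (+ s) * x * x - (+ r) * y * y + ((+ r) - (+ 2)) * (+ s) * x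
  + (+ r) * (+ s) * y - n

-- x ≤ z_n(x,y) ≤ y, cleared of the positive denominator 2rs
-- (equivalent to the rational inequalities since 2rs > 0)
BetweenZ : ℕ → ℕ → ℤ → ℤ → ℤ → Set
BetweenZ r s n x y =
  ((+ 2) * (+ r) * (+ s) * x ≤ numZ r s n x y) ×
  (numZ r s n x y ≤ (+ 2) * (+ r) * (+ s) * y)

_≡_[mod_] : ℤ → ℤ → ℕ → Set
a ≡ b [mod m ] = (+ m) ∣ (a - b)

A : ℕ → ℕ → ℤ → ℤ → ℤ → ℤ → Set
A r s n x₀ y x = (x ≤ 0ℤ) × (x ≡ x₀ [mod r ]) × BetweenZ r s n x y

SpacedInterval : ℕ → (ℤ → Set) → Set
SpacedInterval r P = ∃₂ λ a⁻ a⁺ → (a⁻ ≤ a⁺) × (a⁺ ≡ a⁻ [mod r ]) ×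
  (∀ x → (P x → (a⁻ ≤ x) × (x ≤ a⁺) × (x ≡ a⁻ [mod r ])) ×
         ((a⁻ ≤ x) × (x ≤ a⁺) × (x ≡ a⁻ [mod r ]) → P x))

IsMax : (ℤ → Set) → ℤ → Set
IsMax P a = P a × (∀ x → P x → x ≤ a)

-- Along the progression x ≡ x₀ (mod r), x ≤ 0, the step x ↦ x - r raises numZ(x, y) by
-- 2rs(1 - x) ≥ 2rs while it lowers 2rs·x. So the condition numZ ≤ 2rs·y of A_n(y) holds on an
-- up-set of the progression and 2rs·x ≤ numZ on a down-set: A_n(y) is an interval of it, bounded
-- above by 0 and, by the same growth estimate, below. It is nonempty because f_{r,s} preserves Rec,
-- g and x mod r, raises the height y by s after finitely many left moves, and a recurrent state
-- (x, y, z) with g = n has z_n(x, y) = z ∈ [x, y]. Finally numZ(x, y + s) = numZ(x, y) - 2rs·y, so an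
-- element of A_n(y + s) that is not below a⁺(y) already lies in A_n(y).

module Submission where

open import Defs
open import Data.Nat using (ℕ; NonZero)
open import Data.Integer using (ℤ; +_; _+_; _≤_)
open import Relation.Binary.PropositionalEquality using (_≡_)
open import Data.Product using (_×_)

open import Data.Nat as ℕ using (zero; suc; z≤n; s≤s)
import Data.Nat.Divisibility as ℕ
open import Data.Integer.Base using (_-_; _*_; -_; 0ℤ; 1ℤ; ∣_∣; _<_; +≤+; +<+; Positive; NonNegative; positive; nonNegative)
open import Data.Integer.Properties
import Data.Integer.Divisibility.Signed as Signed
open import Data.Integer.Tactic.RingSolver using (solve-∀)
open import Data.Product using (∃; ∃₂; _,_; proj₁; proj₂)
open import Data.Sum using (inj₁; inj₂)
open import Function using (_∘_)
open import Relation.Binary.PropositionalEquality using (refl; sym; trans; cong; cong₂; subst; subst₂; module ≡-Reasoning)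
open import Relation.Nullary using (yes; no; contradiction)
open import Relation.Nullary.Decidable using (_×-dec_)
open import Relation.Unary using (Decidable)

i+j-j≡i : ∀ i j → i + j - j ≡ i
i+j-j≡i = solve-∀

i+j-i≡j : ∀ i j → i + j - i ≡ j
i+j-i≡j = solve-∀

+-suc-multiple : ∀ i k m → i + + suc k * m ≡ i + + k * m + m
+-suc-multiple i k m = identity i (+ k) m
  where
  identity : ∀ i k m → i + (1ℤ + k) * m ≡ i + k * m + m
  identity = solve-∀

0≤i*j : ∀ {i j} → 0ℤ ≤ i → 0ℤ ≤ j → 0ℤ ≤ i * j
0≤i*j {+ m} {+ n} _ _ = subst (0ℤ ≤_) (pos-* m n) (+≤+ z≤n)

distance-below : ∀ {x u} → x ≤ u → u - + ∣ x - u ∣ ≡ x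
distance-below {x} {u} x≤u = trans (cong (λ d → u - d) (∣-∣-≤ x≤u)) (i-[i-j]≡j u x)
  where
  i-[i-j]≡j : ∀ i j → i - (i - j) ≡ j
  i-[i-j]≡j = solve-∀

distance-above : ∀ {l x} → l ≤ x → l + + ∣ l - x ∣ ≡ x
distance-above {l} {x} l≤x = trans (cong (λ d → l + d) (∣-∣-≤ l≤x)) (i+[j-i]≡j l x)
  where
  i+[j-i]≡j : ∀ i j → i + (j - i) ≡ j
  i+[j-i]≡j = solve-∀

-- a ≡ b [mod m ] unfolds to m ∣ ∣ a - b ∣, from which a and b cannot be inferred: hence the
-- explicit arguments below.
≡[mod]-refl : ∀ {m} x → x ≡ x [mod m ]
≡[mod]-refl {m} x = subst (λ d → m ℕ.∣ ∣ d ∣) (sym (+-inverseʳ x)) (m ℕ.∣0)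

≡[mod]-sym : ∀ {m} a b → a ≡ b [mod m ] → b ≡ a [mod m ]
≡[mod]-sym {m} a b = subst (m ℕ.∣_) (∣i-j∣≡∣j-i∣ a b)

≡[mod]-trans : ∀ {m} a b c → a ≡ b [mod m ] → b ≡ c [mod m ] → a ≡ c [mod m ]
≡[mod]-trans {m} a b c a≡b b≡c = Signed.∣⇒∣ᵤ (subst (+ m Signed.∣_) (+-minus-telescope a b c)
  (Signed.∣m∣n⇒∣m+n (Signed.∣ᵤ⇒∣ {i = a - b} a≡b) (Signed.∣ᵤ⇒∣ {i = b - c} b≡c)))

≡[mod]⇒multiple : ∀ {m a b} → a ≤ b → b ≡ a [mod m ] → ∃ λ k → b ≡ a + + k * + m
≡[mod]⇒multiple {m} {a} {b} a≤b (ℕ.divides k ∣b-a∣≡k*m) = k , (begin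
  b                  ≡⟨ sym (distance-above a≤b) ⟩
  a + + ∣ a - b ∣    ≡⟨ cong (λ d → a + + d) (trans (∣i-j∣≡∣j-i∣ a b) ∣b-a∣≡k*m) ⟩
  a + + (k ℕ.* m)    ≡⟨ cong (λ d → a + d) (pos-* k m) ⟩
  a + + k * + m      ∎)
  where open ≡-Reasoning

i-m≡i[mod] : ∀ i m → (i - + m) ≡ i [mod m ]
i-m≡i[mod] i m = subst (m ℕ.∣_) (sym (trans (cong ∣_∣ (i-j-i≡-j i (+ m))) (∣-i∣≡∣i∣ (+ m)))) ℕ.∣-refl
  where
  i-j-i≡-j : ∀ i j → i - j - i ≡ - j
  i-j-i≡-j = solve-∀

least : {P : ℕ → Set} → Decidable P → ∀ {k} → P k → ∃ λ m → P m × (∀ {j} → P j → m ℕ.≤ j)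
least P? {zero} P0 = 0 , P0 , λ _ → z≤n
least P? {suc k} Pk with P? 0
... | yes P0 = 0 , P0 , λ _ → z≤n
... | no ¬P0 with least (P? ∘ suc) Pk
...   | m , Pm , minimal = suc m , Pm , λ { {zero} P0 → contradiction P0 ¬P0 ; {suc j} Pj → s≤s (minimal Pj) }

IsMin : (ℤ → Set) → ℤ → Set
IsMin P a = P a × (∀ x → P x → a ≤ x)

module _ {P : ℤ → Set} (P? : Decidable P) where

  max-of-boundedAbove : ∀ {u w} → P w → (∀ x → P x → x ≤ u) → ∃ (IsMax P)
  max-of-boundedAbove {u} Pw bound =
    let m , Pm , minimal = least (λ k → P? (u - + k)) (shifted Pw) in
    u - + m , Pm , λ x Px → subst (_≤ u - + m) (distance-below (bound x Px))
                                  (+-monoʳ-≤ u (neg-mono-≤ (+≤+ (minimal (shifted Px)))))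
    where
    shifted : ∀ {x} → P x → P (u - + ∣ x - u ∣)
    shifted {x} Px = subst P (sym (distance-below (bound x Px))) Px

  min-of-boundedBelow : ∀ {l w} → P w → (∀ x → P x → l ≤ x) → ∃ (IsMin P)
  min-of-boundedBelow {l} Pw bound =
    let m , Pm , minimal = least (λ k → P? (l + + k)) (shifted Pw) in
    l + + m , Pm , λ x Px → subst (l + + m ≤_) (distance-above (bound x Px))
                                  (+-monoʳ-≤ l (+≤+ (minimal (shifted Px))))
    where
    shifted : ∀ {x} → P x → P (l + + ∣ l - x ∣)
    shifted {x} Px = subst P (sym (distance-above (bound x Px))) Px

spacedInterval-intro : ∀ {r} {P : ℤ → Set} → Decidable P → ∀ {l u w} → P w →
  (∀ x → P x → l ≤ x) → (∀ x → P x → x ≤ u) →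
  (∀ {x x′} → P x → P x′ → x ≡ x′ [mod r ]) →
  (∀ {a b x} → P a → P b → a ≤ x → x ≤ b → x ≡ a [mod r ] → P x) →
  SpacedInterval r P
spacedInterval-intro P? Pw below above congruent convex
  with min-of-boundedBelow P? Pw below | max-of-boundedAbove P? Pw above
... | a⁻ , Pa⁻ , a⁻-least | a⁺ , Pa⁺ , a⁺-greatest =
  a⁻ , a⁺ , a⁻-least a⁺ Pa⁺ , congruent Pa⁺ Pa⁻ , λ x →
    (λ Px → a⁻-least x Px , a⁺-greatest x Px , congruent Px Pa⁻) ,
    (λ (a⁻≤x , x≤a⁺ , x≡a⁻) → convex Pa⁻ Pa⁺ a⁻≤x x≤a⁺ x≡a⁻)

0<2rs : ∀ r s .{{_ : NonZero r}} .{{_ : NonZero s}} → 0ℤ < (+ 2) * (+ r) * (+ s)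
0<2rs (suc r) (suc s) = +<+ (s≤s z≤n)

module _ (r s : ℕ) .{{_ : NonZero r}} .{{_ : NonZero s}} where

  private
    c : ℤ
    c = (+ 2) * (+ r) * (+ s)

    instance
      c-positive : Positive c
      c-positive = positive (0<2rs r s)

      c-nonNegative : NonNegative c
      c-nonNegative = nonNegative (<⇒≤ (0<2rs r s))

    c*-nonNegative : ∀ {i} → 0ℤ ≤ i → NonNegative (c * i)
    c*-nonNegative 0≤i = nonNegative (0≤i*j (<⇒≤ (0<2rs r s)) 0≤i)

  module _ (n : ℤ) where

    numZ-step : ∀ {x} y → x + + r ≤ 0ℤ → numZ r s n (x + + r) y + c ≤ numZ r s n x y
    numZ-step {x} y x+r≤0 = begin
      Φ (x + + r) + c                     ≡⟨ cong (λ d → Φ (x + + r) + d) (sym (*-identityʳ c)) ⟩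
      Φ (x + + r) + c * 1ℤ                ≤⟨ +-monoʳ-≤ (Φ (x + + r)) (*-monoˡ-≤-nonNeg c 1≤1-[x+r]) ⟩
      Φ (x + + r) + c * (1ℤ - (x + + r))  ≡⟨ sym (identity (+ r) (+ s) n x y) ⟩
      Φ x                                 ∎
      where
      open ≤-Reasoning
      Φ : ℤ → ℤ
      Φ t = numZ r s n t y
      1≤1-[x+r] : 1ℤ ≤ 1ℤ - (x + + r)
      1≤1-[x+r] = +-monoʳ-≤ 1ℤ (neg-mono-≤ x+r≤0)
      identity : ∀ R S n x y →
        S * x * x - R * y * y + (R - + 2) * S * x + R * S * y - n ≡
        (S * (x + R) * (x + R) - R * y * y + (R - + 2) * S * (x + R) + R * S * y - n)
          + + 2 * R * S * (1ℤ - (x + R))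
      identity = solve-∀

    numZ-descent : ∀ k {x} y → x + + k * + r ≤ 0ℤ → numZ r s n (x + + k * + r) y + c * + k ≤ numZ r s n x y
    numZ-descent zero {x} y _ =
      ≤-reflexive (trans (cong₂ _+_ (cong (λ t → numZ r s n t y) (+-identityʳ x)) (*-zeroʳ c)) (+-identityʳ _))
    numZ-descent (suc k) {x} y x+[1+k]r≤0 = begin
      Φ (x + + suc k * + r) + c * + suc k  ≡⟨ cong₂ _+_ (cong Φ (+-suc-multiple x k (+ r))) (*-suc c (+ k)) ⟩
      Φ (x′ + + r) + (c + c * + k)         ≡⟨ sym (+-assoc (Φ (x′ + + r)) c (c * + k)) ⟩
      Φ (x′ + + r) + c + c * + k           ≤⟨ +-monoˡ-≤ (c * + k) (numZ-step y x′+r≤0) ⟩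
      Φ x′ + c * + k                       ≤⟨ numZ-descent k y (≤-trans (i≤i+j x′ (+ r)) x′+r≤0) ⟩
      Φ x                                  ∎
      where
      open ≤-Reasoning
      Φ : ℤ → ℤ
      Φ t = numZ r s n t y
      x′ : ℤ
      x′ = x + + k * + r
      x′+r≤0 : x′ + + r ≤ 0ℤ
      x′+r≤0 = subst (_≤ 0ℤ) (+-suc-multiple x k (+ r)) x+[1+k]r≤0

    numZ-antitone : ∀ {a b} y → a ≤ b → b ≤ 0ℤ → b ≡ a [mod r ] → numZ r s n b y ≤ numZ r s n a y
    numZ-antitone y a≤b b≤0 b≡a with ≡[mod]⇒multiple a≤b b≡a
    ... | k , refl = ≤-trans (i≤i+j _ (c * + k) {{c*-nonNegative (+≤+ z≤n)}}) (numZ-descent k y b≤0)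

    numZ-next-level : ∀ x y → numZ r s n x (y + + s) ≡ numZ r s n x y - c * y
    numZ-next-level = identity (+ r) (+ s) n
      where
      identity : ∀ R S n x y →
        S * x * x - R * (y + S) * (y + S) + (R - + 2) * S * x + R * S * (y + S) - n ≡
        (S * x * x - R * y * y + (R - + 2) * S * x + R * S * y - n) - + 2 * R * S * y
      identity = solve-∀

  numZ-at-g : ∀ x y z → numZ r s (g r s x y z) x y ≡ c * z
  numZ-at-g = identity (+ r) (+ s)
    where
    identity : ∀ R S x y z →
      S * x * x - R * y * y + (R - + 2) * S * x + R * S * y
        - (S * x * x - R * y * y + (R - + 2) * S * x + R * S * y - + 2 * R * S * z) ≡
      + 2 * R * S * z
    identity = solve-∀

  g-moveRight : ∀ x y z → g r s x (y + + s) (z - y) ≡ g r s x y z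
  g-moveRight = identity (+ r) (+ s)
    where
    identity : ∀ R S x y z →
      S * x * x - R * (y + S) * (y + S) + (R - + 2) * S * x + R * S * (y + S) - + 2 * R * S * (z - y) ≡
      S * x * x - R * y * y + (R - + 2) * S * x + R * S * y - + 2 * R * S * z
    identity = solve-∀

  g-moveLeft : ∀ x y z → g r s (x - + r) y (z - x + 1ℤ) ≡ g r s x y z
  g-moveLeft = identity (+ r) (+ s)
    where
    identity : ∀ R S x y z →
      S * (x - R) * (x - R) - R * y * y + (R - + 2) * S * (x - R) + R * S * y - + 2 * R * S * (z - x + 1ℤ) ≡
      S * x * x - R * y * y + (R - + 2) * S * x + R * S * y - + 2 * R * S * z
    identity = solve-∀

  Rec-moveRight : ∀ {x y z} → Rec x y z → x + y ≤ z → Rec x (y + + s) (z - y)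
  Rec-moveRight {x} {y} {z} (x≤0 , 0≤y , _ , z≤y) x+y≤z =
    x≤0 , 0≤y+s , subst (_≤ z - y) (i+j-j≡i x y) (+-monoˡ-≤ (- y) x+y≤z) , ≤-trans (i≤j⇒i-j≤0 z≤y) 0≤y+s
    where
    0≤y+s : 0ℤ ≤ y + + s
    0≤y+s = ≤-trans 0≤y (i≤i+j y (+ s))

  Rec-moveLeft : ∀ {x y z} → Rec x y z → z < x + y → Rec (x - + r) y (z - x + 1ℤ)
  Rec-moveLeft {x} {y} {z} (x≤0 , 0≤y , x≤z , _) z<x+y = i≤j⇒i-k≤j (+ r) x≤0 , 0≤y , x-r≤z-x+1 , z-x+1≤y
    where
    open ≤-Reasoning
    x-r≤z-x+1 : x - + r ≤ z - x + 1ℤ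
    x-r≤z-x+1 = begin
      x - + r      ≤⟨ i-j≤i x (+ r) ⟩
      x            ≤⟨ x≤z ⟩
      z            ≤⟨ i≤i+j z (- x) {{nonNegative (neg-mono-≤ x≤0)}} ⟩
      z - x        ≤⟨ i≤i+j (z - x) 1ℤ ⟩
      z - x + 1ℤ   ∎
    z-x+1≤y : z - x + 1ℤ ≤ y
    z-x+1≤y = subst₂ _≤_ (rearrange x z) (i+j-i≡j x y) (+-monoˡ-≤ (- x) (i<j⇒suc[i]≤j z<x+y))
      where
      rearrange : ∀ x z → 1ℤ + z - x ≡ z - x + 1ℤ
      rearrange = solve-∀

  module _ (n x₀ : ℤ) where

    A? : ∀ y → Decidable (A r s n x₀ y)
    A? y x = x ≤? 0ℤ ×-dec r ℕ.∣? ∣ x - x₀ ∣ ×-dec c * x ≤? numZ r s n x y ×-dec numZ r s n x y ≤? c * y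

    ≡x₀⇒congruent : ∀ x x′ → x ≡ x₀ [mod r ] → x′ ≡ x₀ [mod r ] → x ≡ x′ [mod r ]
    ≡x₀⇒congruent x x′ x≡x₀ x′≡x₀ = ≡[mod]-trans x x₀ x′ x≡x₀ (≡[mod]-sym x′ x₀ x′≡x₀)

    A-congruent : ∀ {y x x′} → A r s n x₀ y x → A r s n x₀ y x′ → x ≡ x′ [mod r ]
    A-congruent {x = x} {x′} (_ , x≡x₀ , _) (_ , x′≡x₀ , _) = ≡x₀⇒congruent x x′ x≡x₀ x′≡x₀

    A-convex : ∀ {y a b x} → A r s n x₀ y a → A r s n x₀ y b → a ≤ x → x ≤ b → x ≡ a [mod r ] →
               A r s n x₀ y x
    A-convex {y} {a} {b} {x} (_ , a≡x₀ , _ , Φa≤cy) (b≤0 , b≡x₀ , cb≤Φb , _) a≤x x≤b x≡a =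
      x≤0 , x≡x₀ , cx≤Φx , ≤-trans (numZ-antitone n y a≤x x≤0 x≡a) Φa≤cy
      where
      open ≤-Reasoning
      x≤0 : x ≤ 0ℤ
      x≤0 = ≤-trans x≤b b≤0
      x≡x₀ : x ≡ x₀ [mod r ]
      x≡x₀ = ≡[mod]-trans x a x₀ x≡a a≡x₀
      cx≤Φx : c * x ≤ numZ r s n x y
      cx≤Φx = begin
        c * x          ≤⟨ *-monoˡ-≤-nonNeg c x≤b ⟩
        c * b          ≤⟨ cb≤Φb ⟩
        numZ r s n b y ≤⟨ numZ-antitone n y x≤b b≤0 (≡x₀⇒congruent b x b≡x₀ x≡x₀) ⟩
        numZ r s n x y ∎

    A-boundedBelow : ∀ {y w x} → A r s n x₀ y w → A r s n x₀ y x → w - (y - w) * + r ≤ x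
    A-boundedBelow {y} {w} {x} (w≤0 , w≡x₀ , cw≤Φw , Φw≤cy) (_ , x≡x₀ , _ , Φx≤cy) with ≤-total x w
    ... | inj₂ w≤x = ≤-trans (i-j≤i w ((y - w) * + r) {{nonNegative 0≤[y-w]r}}) w≤x
      where
      0≤[y-w]r : 0ℤ ≤ (y - w) * + r
      0≤[y-w]r = 0≤i*j (i≤j⇒0≤j-i (*-cancelˡ-≤-pos w y c (≤-trans cw≤Φw Φw≤cy))) (+≤+ z≤n)
    ... | inj₁ x≤w with ≡[mod]⇒multiple x≤w (≡x₀⇒congruent w x w≡x₀ x≡x₀)
    ...   | k , refl = begin
      w - (y - w) * + r  ≤⟨ +-monoʳ-≤ w (neg-mono-≤ (*-monoʳ-≤-nonNeg (+ r) k≤y-w)) ⟩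
      w - + k * + r      ≡⟨ i+j-j≡i x (+ k * + r) ⟩
      x                  ∎
      where
      open ≤-Reasoning
      w+k≤y : w + + k ≤ y
      w+k≤y = *-cancelˡ-≤-pos (w + + k) y c (begin
        c * (w + + k)              ≡⟨ *-distribˡ-+ c w (+ k) ⟩
        c * w + c * + k            ≤⟨ +-monoˡ-≤ (c * + k) cw≤Φw ⟩
        numZ r s n w y + c * + k   ≤⟨ numZ-descent n k y w≤0 ⟩
        numZ r s n x y             ≤⟨ Φx≤cy ⟩
        c * y                      ∎)
      k≤y-w : + k ≤ y - w
      k≤y-w = subst (_≤ y - w) (i+j-i≡j w (+ k)) (+-monoˡ-≤ (- w) w+k≤y)

    A-spacedInterval : ∀ {y w} → A r s n x₀ y w → SpacedInterval r (A r s n x₀ y)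
    A-spacedInterval {y} Aw =
      spacedInterval-intro (A? y) Aw (λ _ → A-boundedBelow Aw) (λ _ → proj₁) A-congruent A-convex

    A-max-antitone : ∀ {y a b} → 0ℤ ≤ y → IsMax (A r s n x₀ y) a → IsMax (A r s n x₀ (y + + s)) b → b ≤ a
    A-max-antitone {y} {a} {b} 0≤y ((_ , a≡x₀ , _ , Φa≤cy) , a-greatest) ((b≤0 , b≡x₀ , cb≤Φ′b , _) , _)
      with ≤-total b a
    ... | inj₁ b≤a = b≤a
    ... | inj₂ a≤b = a-greatest b (b≤0 , b≡x₀ , cb≤Φb , Φb≤cy)
      where
      cb≤Φb : c * b ≤ numZ r s n b y
      cb≤Φb = ≤-trans (subst (c * b ≤_) (numZ-next-level n b y) cb≤Φ′b)
                      (i-j≤i (numZ r s n b y) (c * y) {{c*-nonNegative 0≤y}})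
      Φb≤cy : numZ r s n b y ≤ c * y
      Φb≤cy = ≤-trans (numZ-antitone n y a≤b b≤0 (≡x₀⇒congruent b a b≡x₀ a≡x₀)) Φa≤cy

    StateAt : ℤ → Set
    StateAt y = ∃₂ λ x z → Rec x y z × g r s x y z ≡ n × (x ≡ x₀ [mod r ])

    StateAt⇒A : ∀ {y} → StateAt y → ∃ (A r s n x₀ y)
    StateAt⇒A {y} (x , z , (x≤0 , _ , x≤z , z≤y) , g≡n , x≡x₀) =
      x , x≤0 , x≡x₀ , subst (c * x ≤_) (sym Φ≡cz) (*-monoˡ-≤-nonNeg c x≤z) ,
                       subst (_≤ c * y) (sym Φ≡cz) (*-monoˡ-≤-nonNeg c z≤y)
      where
      Φ≡cz : numZ r s n x y ≡ c * z
      Φ≡cz = subst (λ m → numZ r s m x y ≡ c * z) g≡n (numZ-at-g x y z)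

    -- One round of f_{r,s}: left moves until x + y ≤ z, then a right move. A left move lowers y - z
    -- by 1 - x ≥ 1, so y - z bounds the number of left moves.
    climb : ∀ fuel {x y z} → Rec x y z → g r s x y z ≡ n → x ≡ x₀ [mod r ] → y - z ≤ + fuel →
            StateAt (y + + s)
    climb fuel {x} {y} {z} σ g≡n x≡x₀ y-z≤fuel with x + y ≤? z
    ... | yes x+y≤z = x , z - y , Rec-moveRight σ x+y≤z , trans (g-moveRight x y z) g≡n , x≡x₀
    climb zero {x} {y} {z} (x≤0 , _ , _ , _) _ _ y-z≤0 | no x+y≰z = contradiction x+y≤z x+y≰z
      where
      x+y≤z : x + y ≤ z
      x+y≤z = ≤-trans (subst (x + y ≤_) (+-identityˡ y) (+-monoˡ-≤ y x≤0)) (i-j≤0⇒i≤j y-z≤0)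
    climb (suc fuel) {x} {y} {z} σ@(x≤0 , _ , _ , _) g≡n x≡x₀ y-z≤1+fuel | no x+y≰z =
      climb fuel (Rec-moveLeft σ (≰⇒> x+y≰z)) (trans (g-moveLeft x y z) g≡n)
        (≡[mod]-trans (x - + r) x x₀ (i-m≡i[mod] x r) x≡x₀) y-z′≤fuel
      where
      open ≤-Reasoning
      y-z′≤fuel : y - (z - x + 1ℤ) ≤ + fuel
      y-z′≤fuel = begin
        y - (z - x + 1ℤ)     ≡⟨ rearrange x y z ⟩
        y - z - 1ℤ + x       ≤⟨ +-monoʳ-≤ (y - z - 1ℤ) x≤0 ⟩
        y - z - 1ℤ + 0ℤ      ≡⟨ +-identityʳ _ ⟩
        y - z - 1ℤ           ≤⟨ +-monoˡ-≤ (- 1ℤ) y-z≤1+fuel ⟩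
        + fuel               ∎
        where
        rearrange : ∀ x y z → y - (z - x + 1ℤ) ≡ y - z - 1ℤ + x
        rearrange = solve-∀

    climb-once : ∀ {y} → StateAt y → StateAt (y + + s)
    climb-once {y} (x , z , σ@(_ , _ , _ , z≤y) , g≡n , x≡x₀) =
      climb ∣ y - z ∣ σ g≡n x≡x₀ (≤-reflexive (sym (0≤i⇒+∣i∣≡i (i≤j⇒0≤j-i z≤y))))

    climb-by : ∀ k {y} → StateAt y → StateAt (y + + k * + s)
    climb-by zero {y} σ = subst StateAt (sym (+-identityʳ y)) σ
    climb-by (suc k) {y} σ = subst StateAt (sym (+-suc-multiple y k (+ s))) (climb-once (climb-by k σ))

    A-nonempty : ∀ {y₀ z₀ y} → Rec x₀ y₀ z₀ → g r s x₀ y₀ z₀ ≡ n → y₀ ≤ y → y ≡ y₀ [mod s ] →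
                 ∃ (A r s n x₀ y)
    A-nonempty {y₀} {z₀} σ₀ g≡n y₀≤y y≡y₀ with ≡[mod]⇒multiple y₀≤y y≡y₀
    ... | k , refl = StateAt⇒A (climb-by k (x₀ , z₀ , σ₀ , g≡n , ≡[mod]-refl x₀))

lemma2p8 : (r s : ℕ) → .{{NonZero r}} → .{{NonZero s}} → (n : ℤ) →
    (x₀ y₀ z₀ : ℤ) → Rec x₀ y₀ z₀ → g r s x₀ y₀ z₀ ≡ n →
    (y : ℤ) → y₀ ≤ y → y ≡ y₀ [mod s ] →
    SpacedInterval r (A r s n x₀ y) ×
    (∀ a b → IsMax (A r s n x₀ y) a → IsMax (A r s n x₀ (y + + s)) b → b ≤ a)
lemma2p8 r s n x₀ y₀ z₀ σ₀ g≡n y y₀≤y y≡y₀ =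
  A-spacedInterval r s n x₀ (proj₂ (A-nonempty r s n x₀ σ₀ g≡n y₀≤y y≡y₀)) ,
  λ _ _ → A-max-antitone r s n x₀ (≤-trans (proj₁ (proj₂ σ₀)) y₀≤y)
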